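{- Let $F=\{F_n:n\geqslant 2\}=\{1,2,3,5,8,13,\ldots\}$ be the set of Fibonacci numbers. For all integers $a,b\geqslant 6$, we have $p_F(a)\,p_F(b)>p_F(a+b)$.
   Context: $F_n$ denotes the Fibonacci sequence with $F_0=0$, $F_1=1$, $F_{n}=F_{n-1}+F_{n-2}$. The Fibonacci partition function $p_F(n)$ is the number of partitions of $n$ all of whose parts belong to $F$. -}

module Defs where

open import Data.Nat using (ℕ; zero; suc; _+_; _∸_; _<ᵇ_)
open import Data.Bool using (if_then_else_)
open import Data.List using (List; []; _∷_; map; upTo)

F : ℕ → ℕ
F zero = 0
F (suc zero) = 1
F (suc (suc n)) = F (suc n) + F n

fibParts : ℕ → List ℕ
fibParts k = map (λ i → F (suc (suc i))) (upTo k)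

-- count ps n = number of partitions of n (multisets of parts summing to n)
-- all of whose parts lie in the list ps of distinct positive integers.
-- Standard recursion: either no copy of the first part is used, or at least
-- one is (fuel = n bounds the recursion depth, since parts are ≥ 1).
countFuel : ℕ → List ℕ → ℕ → ℕ
countFuel fuel [] zero = 1
countFuel fuel [] (suc n) = 0
countFuel zero (p ∷ ps) n = countFuel zero ps n
countFuel (suc fuel) (p ∷ ps) n =
  countFuel (suc fuel) ps n
  + (if n <ᵇ p then 0 else (if p <ᵇ 1 then 0 else countFuel fuel (p ∷ ps) (n ∸ p)))

-- p_F n: number of partitions of n into parts from {F_k : k ≥ 2}.
-- Parts exceeding n cannot occur, and F_{k+2} ≥ k+1, so F_2..F_{n+1} suffice.
pF : ℕ → ℕ
pF n = countFuel n (fibParts (suc n)) n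

-- Let P k n be the number of partitions of n into the parts F₂, …, F_{k+1}. Since countFuel
-- recurses on the first (smallest) part, one first shows that the count is invariant under
-- permuting the parts; this yields P (k+1) n = P k n + P (k+1) (n − F_{k+2}) for n ≥ F_{k+2},
-- P (k+1) n = P k n below F_{k+2}, and hence pF n = P k n once n < F_{k+2}.
--
-- The theorem then follows from P k (x+y) ≤ P k x · P k y for k, x, y ≥ 2, strict as soon as
-- x or y is at least 16, proved by induction on x + y. Pairs with x, y < 16 are checked by
-- computation (levels beyond 7 change nothing there). For 2 ≤ y ≤ x with 16 ≤ x, induction on
-- the level k gives the stronger bound P k (x+y) + c · P k y < P k x · P k y, with c = 3, 2, 1
-- once x ≥ F_{k+2}, F_{k+1}, F_k respectively and c = 0 always. Either x ≥ F_{k+1} and the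
-- recurrence splits the largest part F_{k+1} off x, or x < F_{k+1}, in which case passing from
-- level k − 1 to k leaves P x and P y unchanged and adds at most P y to P (x+y), which the
-- margin at level k − 1 pays for.

module Submission where

open import Data.Bool using (true; false)
open import Data.Bool.Properties using (T-≡)
open import Data.Empty using (⊥-elim)
open import Data.List using (List; []; _∷_; _∷ʳ_; map; upTo)
open import Data.List.Properties using (map-++; upTo-∷ʳ)
open import Data.List.Relation.Binary.Permutation.Propositional as ↭ using (_↭_)
open import Data.List.Relation.Binary.Permutation.Propositional.Properties using (∷↭∷ʳ)
open import Data.Nat
  using (ℕ; zero; suc; _+_; _*_; _∸_; _<_; _≤_; _≤′_; ≤′-refl; ≤′-step; _<ᵇ_; _≤?_; _<?_;
         z≤n; s≤s; z<s; s<s; NonZero; >-nonZero)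
open import Data.Nat.Induction using (<-wellFounded)
open import Data.Nat.Properties
open import Data.Nat.Tactic.RingSolver using (solve-∀)
open import Data.Product using (_,_)
open import Data.Sum using (_⊎_; inj₁; inj₂; [_,_]′)
open import Function using (Equivalence; _∘_; id; flip)
open import Induction.WellFounded using (Acc; acc)
open import Relation.Binary.PropositionalEquality
open import Relation.Nullary using (Dec; yes; no)
open import Relation.Nullary.Decidable using (toWitness; _→-dec_; _⊎-dec_)

open import Algebra.Properties.CommutativeSemigroup +-commutativeSemigroup using (x∙yz≈y∙xz; xy∙z≈xz∙y)
open import Defs

-- Counting partitions with parts from a list

count : List ℕ → ℕ → ℕ
count ps n = countFuel n ps n

countFuel-zero : ∀ fuel ps → countFuel fuel ps 0 ≡ 1
countFuel-zero zero    []           = refl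
countFuel-zero zero    (p ∷ ps)     = countFuel-zero zero ps
countFuel-zero (suc f) []           = refl
countFuel-zero (suc f) (zero ∷ ps)  = cong (_+ 0) (countFuel-zero (suc f) ps)
countFuel-zero (suc f) (suc p ∷ ps) = cong (_+ 0) (countFuel-zero (suc f) ps)

countFuel-irrelevant : ∀ {f g} ps n → n ≤ f → n ≤ g → countFuel f ps n ≡ countFuel g ps n
countFuel-irrelevant {f} {g} ps zero _ _ = trans (countFuel-zero f ps) (sym (countFuel-zero g ps))
countFuel-irrelevant {suc f} {suc g} [] (suc n) _ _ = refl
countFuel-irrelevant {suc f} {suc g} (p ∷ ps) (suc n) n<f n<g
  rewrite countFuel-irrelevant ps (suc n) n<f n<g with suc n <ᵇ p
... | true = refl
... | false with p
...   | zero   = refl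
...   | suc p′ = cong (countFuel (suc g) ps (suc n) +_)
                   (countFuel-irrelevant (suc p′ ∷ ps) (n ∸ p′)
                     (≤-trans (m∸n≤m n p′) (≤-pred n<f)) (≤-trans (m∸n≤m n p′) (≤-pred n<g)))

count-below : ∀ {p} ps {n} → n < p → count (p ∷ ps) n ≡ count ps n
count-below ps {zero}  _   = refl
count-below ps {suc n} n<p rewrite Equivalence.to T-≡ (<⇒<ᵇ n<p) = +-identityʳ _

m+n<ᵇn≡false : ∀ m n → (m + n <ᵇ n) ≡ false
m+n<ᵇn≡false zero    zero    = refl
m+n<ᵇn≡false (suc m) zero    = refl
m+n<ᵇn≡false m       (suc n) rewrite +-suc m n = m+n<ᵇn≡false m n

count-above : ∀ {p} {{_ : NonZero p}} ps {m n} → n ≡ m + p →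
              count (p ∷ ps) n ≡ count ps n + count (p ∷ ps) m
count-above {suc p} ps {m} refl rewrite +-suc m p | m+n<ᵇn≡false m p =
  cong (count ps (suc (m + p)) +_)
    (trans (cong (countFuel (m + p) (suc p ∷ ps)) (m+n∸n≡m m p))
           (countFuel-irrelevant (suc p ∷ ps) m (m≤m+n m p) ≤-refl))

count-zero-part : ∀ ps n → count (0 ∷ ps) n ≡ count ps n
count-zero-part ps zero    = refl
count-zero-part ps (suc n) = +-identityʳ _

data Split (p n : ℕ) : Set where
  below : n < p → Split p n
  above : ∀ m → n ≡ m + p → Split p n

split : ∀ p n → Split p n
split p n with n <? p
... | yes n<p = below n<p
... | no  n≮p = above (n ∸ p) (sym (m∸n+n≡m (≮⇒≥ n≮p)))

n≡m+suc⇒m<n : ∀ {m n p} → n ≡ m + suc p → m < n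
n≡m+suc⇒m<n {m} {p = p} refl = m<m+n m z<s

module _ (p q : ℕ) (ps : List ℕ) where
  private
    L R CP CQ C : ℕ → ℕ
    L  = count (suc p ∷ suc q ∷ ps)
    R  = count (suc q ∷ suc p ∷ ps)
    CP = count (suc p ∷ ps)
    CQ = count (suc q ∷ ps)
    C  = count ps

  SwapsBelow : ℕ → Set
  SwapsBelow n = ∀ {k} → k < n → L k ≡ R k

  count-swap-below-above : ∀ {n m′} → SwapsBelow n → n < suc p → n ≡ m′ + suc q → L n ≡ R n
  count-swap-below-above {n} {m′} rec n<P n≡ = begin
    L n            ≡⟨ count-below (suc q ∷ ps) n<P ⟩
    CQ n           ≡⟨ count-above ps n≡ ⟩
    C n + CQ m′    ≡⟨ cong (C n +_) (sym (count-below (suc q ∷ ps) m′<P)) ⟩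
    C n + L m′     ≡⟨ cong (C n +_) (rec (n≡m+suc⇒m<n n≡)) ⟩
    C n + R m′     ≡⟨ cong (_+ R m′) (sym (count-below ps n<P)) ⟩
    CP n + R m′    ≡⟨ sym (count-above (suc p ∷ ps) n≡) ⟩
    R n            ∎
    where
      open ≡-Reasoning
      m′<P : m′ < suc p
      m′<P = <-trans (n≡m+suc⇒m<n n≡) n<P

  count-swap-above-above : ∀ {n m m′} → SwapsBelow n → n ≡ m + suc p → n ≡ m′ + suc q → L n ≡ R n
  count-swap-above-above {n} {m} {m′} rec n≡m+P n≡m′+Q = begin
    L n                   ≡⟨ count-above (suc q ∷ ps) n≡m+P ⟩
    CQ n + L m            ≡⟨ cong (_+ L m) (count-above ps n≡m′+Q) ⟩
    (C n + CQ m′) + L m   ≡⟨ +-assoc (C n) (CQ m′) (L m) ⟩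
    C n + (CQ m′ + L m)   ≡⟨ cong (C n +_) (tails (split (suc q) m)) ⟩
    C n + (CP m + R m′)   ≡⟨ sym (+-assoc (C n) (CP m) (R m′)) ⟩
    (C n + CP m) + R m′   ≡⟨ cong (_+ R m′) (sym (count-above ps n≡m+P)) ⟩
    CP n + R m′           ≡⟨ sym (count-above (suc p ∷ ps) n≡m′+Q) ⟩
    R n                   ∎
    where
      open ≡-Reasoning
      m+P≡m′+Q : m + suc p ≡ m′ + suc q
      m+P≡m′+Q = trans (sym n≡m+P) n≡m′+Q
      m<n : m < n
      m<n = n≡m+suc⇒m<n n≡m+P
      m′<n : m′ < n
      m′<n = n≡m+suc⇒m<n n≡m′+Q
      tails : Split (suc q) m → CQ m′ + L m ≡ CP m + R m′
      tails (below m<Q) = begin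
        CQ m′ + L m   ≡⟨ cong₂ _+_ (sym (count-below (suc q ∷ ps) m′<P)) (rec m<n) ⟩
        L m′ + R m    ≡⟨ cong₂ _+_ (rec m′<n) (count-below (suc p ∷ ps) m<Q) ⟩
        R m′ + CP m   ≡⟨ +-comm (R m′) (CP m) ⟩
        CP m + R m′   ∎
        where
          m′<P : m′ < suc p
          m′<P = +-cancelʳ-< (suc q) m′ (suc p)
                   (subst (_< suc p + suc q) m+P≡m′+Q
                     (subst (m + suc p <_) (+-comm (suc q) (suc p)) (+-monoˡ-< (suc p) m<Q)))
      tails (above r m≡r+Q) = begin
        CQ m′ + L m          ≡⟨ cong (CQ m′ +_) (trans (rec m<n) (count-above (suc p ∷ ps) m≡r+Q)) ⟩
        CQ m′ + (CP m + R r) ≡⟨ x∙yz≈y∙xz (CQ m′) (CP m) (R r) ⟩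
        CP m + (CQ m′ + R r) ≡⟨ cong (λ z → CP m + (CQ m′ + z)) (sym (rec r<n)) ⟩
        CP m + (CQ m′ + L r) ≡⟨ cong (CP m +_) (sym (count-above (suc q ∷ ps) m′≡r+P)) ⟩
        CP m + L m′          ≡⟨ cong (CP m +_) (rec m′<n) ⟩
        CP m + R m′          ∎
        where
          r<n : r < n
          r<n = <-trans (n≡m+suc⇒m<n m≡r+Q) m<n
          m′≡r+P : m′ ≡ r + suc p
          m′≡r+P = +-cancelʳ-≡ (suc q) m′ (r + suc p) (begin
            m′ + suc q           ≡⟨ sym m+P≡m′+Q ⟩
            m + suc p            ≡⟨ cong (_+ suc p) m≡r+Q ⟩
            r + suc q + suc p    ≡⟨ xy∙z≈xz∙y r (suc q) (suc p) ⟩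
            r + suc p + suc q    ∎)

count-swap-suc : ∀ p q ps n → count (suc p ∷ suc q ∷ ps) n ≡ count (suc q ∷ suc p ∷ ps) n
count-swap-suc p q ps n = go n (<-wellFounded n)
  where
    open ≡-Reasoning
    go : ∀ n → Acc _<_ n → count (suc p ∷ suc q ∷ ps) n ≡ count (suc q ∷ suc p ∷ ps) n
    go n (acc rs) with split (suc p) n | split (suc q) n
    ... | below n<P  | below n<Q   = begin
      count (suc p ∷ suc q ∷ ps) n  ≡⟨ count-below (suc q ∷ ps) n<P ⟩
      count (suc q ∷ ps) n          ≡⟨ count-below ps n<Q ⟩
      count ps n                    ≡⟨ sym (count-below ps n<P) ⟩
      count (suc p ∷ ps) n          ≡⟨ sym (count-below (suc p ∷ ps) n<Q) ⟩
      count (suc q ∷ suc p ∷ ps) n  ∎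
    ... | below n<P  | above _ eq  = count-swap-below-above p q ps (λ k<n → go _ (rs k<n)) n<P eq
    ... | above _ eq | below n<Q   = sym (count-swap-below-above q p ps (λ k<n → sym (go _ (rs k<n))) n<Q eq)
    ... | above _ eq | above _ eq′ = count-swap-above-above p q ps (λ k<n → go _ (rs k<n)) eq eq′

count-cong-∷ : ∀ p {ps qs} → (∀ n → count ps n ≡ count qs n) →
               ∀ n → count (p ∷ ps) n ≡ count (p ∷ qs) n
count-cong-∷ zero    {ps} {qs} ps≗qs n =
  trans (count-zero-part ps n) (trans (ps≗qs n) (sym (count-zero-part qs n)))
count-cong-∷ (suc p) {ps} {qs} ps≗qs n = go n (<-wellFounded n)
  where
    go : ∀ n → Acc _<_ n → count (suc p ∷ ps) n ≡ count (suc p ∷ qs) n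
    go n (acc rs) with split (suc p) n
    ... | below n<P  = trans (count-below ps n<P) (trans (ps≗qs n) (sym (count-below qs n<P)))
    ... | above m eq = trans (count-above ps eq)
                         (trans (cong₂ _+_ (ps≗qs n) (go m (rs (n≡m+suc⇒m<n eq))))
                                (sym (count-above qs eq)))

count-swap : ∀ p q ps n → count (p ∷ q ∷ ps) n ≡ count (q ∷ p ∷ ps) n
count-swap zero    q       ps n =
  trans (count-zero-part (q ∷ ps) n) (count-cong-∷ q (λ k → sym (count-zero-part ps k)) n)
count-swap (suc p) zero    ps n =
  trans (count-cong-∷ (suc p) (count-zero-part ps) n) (sym (count-zero-part (suc p ∷ ps) n))
count-swap (suc p) (suc q) ps n = count-swap-suc p q ps n

count-↭ : ∀ {ps qs} → ps ↭ qs → ∀ n → count ps n ≡ count qs n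
count-↭ ↭.refl               n = refl
count-↭ (↭.prep p ps↭qs)     n = count-cong-∷ p (count-↭ ps↭qs) n
count-↭ (↭.swap p q ps↭qs)   n =
  trans (count-swap p q _ n) (count-cong-∷ q (count-cong-∷ p (count-↭ ps↭qs)) n)
count-↭ (↭.trans ps↭qs qs↭rs) n = trans (count-↭ ps↭qs n) (count-↭ qs↭rs n)

-- Partitions into Fibonacci numbers

fibPart : ℕ → ℕ
fibPart i = F (suc (suc i))

0<F-suc : ∀ n → 0 < F (suc n)
0<F-suc zero    = z<s
0<F-suc (suc n) = ≤-trans (0<F-suc n) (m≤m+n _ _)

fibPart-nonZero : ∀ i → NonZero (fibPart i)
fibPart-nonZero i = >-nonZero (0<F-suc (suc i))

fibPart-≤-suc : ∀ i → fibPart i ≤ fibPart (suc i)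
fibPart-≤-suc i = m≤m+n _ _

fibPart-mono : ∀ {i j} → i ≤ j → fibPart i ≤ fibPart j
fibPart-mono = go ∘ ≤⇒≤′
  where
    go : ∀ {i j} → i ≤′ j → fibPart i ≤ fibPart j
    go ≤′-refl        = ≤-refl
    go (≤′-step {j} i≤′j) = ≤-trans (go i≤′j) (fibPart-≤-suc j)

n<fibPart : ∀ n → n < fibPart n
n<fibPart zero    = z<s
n<fibPart (suc n) = ≤-trans (s≤s (n<fibPart n)) (m<m+n (fibPart n) (0<F-suc n))

opaque
  P : ℕ → ℕ → ℕ
  P k = count (fibParts k)

opaque
  unfolding P

  P-suc : ∀ k n → P (suc k) n ≡ count (fibPart k ∷ fibParts k) n
  P-suc k n = begin
    P (suc k) n                           ≡⟨ cong (λ ps → count ps n) fibParts-suc ⟩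
    count (fibParts k ∷ʳ fibPart k) n     ≡⟨ sym (count-↭ (∷↭∷ʳ (fibPart k) (fibParts k)) n) ⟩
    count (fibPart k ∷ fibParts k) n      ∎
    where
      open ≡-Reasoning
      fibParts-suc : fibParts (suc k) ≡ fibParts k ∷ʳ fibPart k
      fibParts-suc = trans (cong (map fibPart) (sym (upTo-∷ʳ k))) (map-++ fibPart (upTo k) (k ∷ []))

  P-suc-below : ∀ k {n} → n < fibPart k → P (suc k) n ≡ P k n
  P-suc-below k {n} n<f = trans (P-suc k n) (count-below (fibParts k) n<f)

  P-suc-above : ∀ k m {n} → n ≡ m + fibPart k → P (suc k) n ≡ P k n + P (suc k) m
  P-suc-above k m {n} n≡ = begin
    P (suc k) n                                ≡⟨ P-suc k n ⟩
    count (fibPart k ∷ fibParts k) n           ≡⟨ count-above {{fibPart-nonZero k}} (fibParts k) {m} n≡ ⟩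
    P k n + count (fibPart k ∷ fibParts k) m   ≡⟨ cong (P k n +_) (sym (P-suc k m)) ⟩
    P k n + P (suc k) m                        ∎
    where open ≡-Reasoning

  -- The first part in fibParts (suc k) is F₂ = 1.
  P-≤-suc : ∀ k n → P (suc k) n ≤ P (suc k) (suc n)
  P-≤-suc k n = ≤-trans (m≤n+m _ _) (≤-reflexive (sym (count-above {1} _ {n} (sym (+-comm n 1)))))

  pF≡P-suc : ∀ n → pF n ≡ P (suc n) n
  pF≡P-suc n = refl

P-stable : ∀ {k l n} → k ≤ l → n < fibPart k → P l n ≡ P k n
P-stable {k} {n = n} k≤l n<f = go (≤⇒≤′ k≤l)
  where
    go : ∀ {l} → k ≤′ l → P l n ≡ P k n
    go ≤′-refl          = refl
    go (≤′-step {l} k≤′l) =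
      trans (P-suc-below l (<-≤-trans n<f (fibPart-mono (≤′⇒≤ k≤′l)))) (go k≤′l)

P-≤-suc-level : ∀ k n → P k n ≤ P (suc k) n
P-≤-suc-level k n with split (fibPart k) n
... | below n<f  = ≤-reflexive (sym (P-suc-below k n<f))
... | above m eq = ≤-trans (m≤m+n _ _) (≤-reflexive (sym (P-suc-above k m eq)))

P-level-mono : ∀ {k l} n → k ≤ l → P k n ≤ P l n
P-level-mono {k} n k≤l = go (≤⇒≤′ k≤l)
  where
    go : ∀ {l} → k ≤′ l → P k n ≤ P l n
    go ≤′-refl            = ≤-refl
    go (≤′-step {l} k≤′l) = ≤-trans (go k≤′l) (P-≤-suc-level l n)

P-mono : ∀ k {m n} → m ≤ n → P (suc k) m ≤ P (suc k) n
P-mono k {m} = go ∘ ≤⇒≤′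
  where
    go : ∀ {n} → m ≤′ n → P (suc k) m ≤ P (suc k) n
    go ≤′-refl            = ≤-refl
    go (≤′-step {n} m≤′n) = ≤-trans (go m≤′n) (P-≤-suc k n)

pF≡P : ∀ {k n} → n < fibPart k → pF n ≡ P k n
pF≡P {k} {n} n<f with ≤-total k (suc n)
... | inj₁ k≤1+n = trans (pF≡P-suc n) (P-stable k≤1+n n<f)
... | inj₂ 1+n≤k = trans (pF≡P-suc n) (sym (P-stable 1+n≤k (<-≤-trans (n<fibPart n) (fibPart-≤-suc n))))

-- Submultiplicativity with a margin

margin-add : ∀ {c S T X Y Y′ Z} → S + c * Y < X * Y → T ≤ Z * Y′ → c ≤ X → Y ≤ Y′ →
             S + T + c * Y′ < (X + Z) * Y′
margin-add {c} {S} {T} {X} {Y} {Y′} {Z} S+cY<XY T≤ZY′ c≤X Y≤Y′ with m≤n⇒∃[o]m+o≡n Y≤Y′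
... | E , refl = begin-strict
  S + T + c * (Y + E)             ≡⟨ regroup S T c Y E ⟩
  S + c * Y + c * E + T           <⟨ +-mono-<-≤ (+-mono-<-≤ S+cY<XY (*-monoˡ-≤ E c≤X)) T≤ZY′ ⟩
  X * Y + X * E + Z * (Y + E)     ≡⟨ expand X Y E Z ⟩
  (X + Z) * (Y + E)               ∎
  where
    open ≤-Reasoning
    regroup : ∀ S T c Y E → S + T + c * (Y + E) ≡ S + c * Y + c * E + T
    regroup = solve-∀
    expand : ∀ X Y E Z → X * Y + X * E + Z * (Y + E) ≡ (X + Z) * (Y + E)
    expand = solve-∀

margin-add-2 : ∀ {S T X Y Y′ Z} → S + 3 * Y < X * Y → T ≤ Z * Y′ + Y′ → 3 ≤ X → Y ≤ Y′ →
               S + T + 2 * Y′ < (X + Z) * Y′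
margin-add-2 {S} {T} {X} {Y} {Y′} {Z} S+3Y<XY T≤ZY′+Y′ 3≤X Y≤Y′ = begin-strict
  S + T + 2 * Y′               ≤⟨ +-monoˡ-≤ (2 * Y′) (+-monoʳ-≤ S T≤ZY′+Y′) ⟩
  S + (Z * Y′ + Y′) + 2 * Y′   ≡⟨ regroup S Z Y′ ⟩
  S + Z * Y′ + 3 * Y′          <⟨ margin-add {S = S} {T = Z * Y′} S+3Y<XY ≤-refl 3≤X Y≤Y′ ⟩
  (X + Z) * Y′                 ∎
  where
    open ≤-Reasoning
    regroup : ∀ S Z Y → S + (Z * Y + Y) + 2 * Y ≡ S + Z * Y + 3 * Y
    regroup = solve-∀

margin-base : ∀ {S A B} → S ≤ A + B → 9 ≤ A → 2 ≤ B → S + 3 * B < A * B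
margin-base {S} S≤A+B 9≤A 2≤B with m≤n⇒∃[o]m+o≡n 9≤A | m≤n⇒∃[o]m+o≡n 2≤B
... | a , refl | b , refl = begin-strict
  S + 3 * (2 + b)                        ≤⟨ +-monoˡ-≤ (3 * (2 + b)) S≤A+B ⟩
  9 + a + (2 + b) + 3 * (2 + b)          <⟨ m<m+n _ z<s ⟩
  9 + a + (2 + b) + 3 * (2 + b) + 1      ≤⟨ m≤m+n _ (a + 5 * b + a * b) ⟩
  _                                      ≡⟨ expand a b ⟩
  (9 + a) * (2 + b)                      ∎
  where
    open ≤-Reasoning
    expand : ∀ a b → 9 + a + (2 + b) + 3 * (2 + b) + 1 + (a + 5 * b + a * b) ≡ (9 + a) * (2 + b)
    expand = solve-∀

opaque
  unfolding P

  P-one : ∀ n → P 1 n ≡ 1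
  P-one zero    = refl
  P-one (suc n) = trans (count-above {1} [] {n} (sym (+-comm n 1))) (P-one n)

  P-two-one : P 2 1 ≡ 1
  P-two-one = refl

  P-two-two : P 2 2 ≡ 2
  P-two-two = refl

  P-three-three : P 3 3 ≡ 3
  P-three-three = refl

  P-two-sixteen : P 2 16 ≡ 9
  P-two-sixteen = refl

P-suc-one : ∀ k → P (suc k) 1 ≡ 1
P-suc-one k = trans (P-stable {1} {suc k} {1} (s≤s z≤n) (s<s z<s)) (P-one 1)

P-two : ∀ {k} → 2 ≤ k → P k 2 ≡ 2
P-two 2≤k = trans (P-stable 2≤k (s<s (s<s z<s))) P-two-two

P-three-≤ : ∀ k → P k 3 ≤ 3
P-three-≤ k = ≤-trans (P-level-mono 3 (m≤n+m k 3))
                      (≤-reflexive (trans (P-stable (m≤m+n 3 k) (s<s (s<s (s<s z<s)))) P-three-three))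

P-two-2+ : ∀ m → P 2 (2 + m) ≡ suc (P 2 m)
P-two-2+ m = trans (P-suc-above 1 m (+-comm 2 m)) (cong (_+ P 2 m) (P-one (2 + m)))

P-two-suc-≤ : ∀ n → P 2 (suc n) ≤ suc (P 2 n)
P-two-suc-≤ zero          = subst (_≤ suc (P 2 0)) (sym P-two-one) (s≤s z≤n)
P-two-suc-≤ (suc zero)    = ≤-reflexive (trans P-two-two (cong suc (sym P-two-one)))
P-two-suc-≤ (suc (suc n)) rewrite P-two-2+ (suc n) | P-two-2+ n = s≤s (P-two-suc-≤ n)

P-two-subadditive : ∀ m n → P 2 (m + n) ≤ P 2 m + P 2 n
P-two-subadditive zero          n = m≤n+m (P 2 n) (P 2 0)
P-two-subadditive (suc zero)    n rewrite P-two-one = P-two-suc-≤ n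
P-two-subadditive (suc (suc m)) n rewrite P-two-2+ (m + n) | P-two-2+ m = s≤s (P-two-subadditive m n)

SubmultiplicativeBelow : ℕ → Set
SubmultiplicativeBelow s =
  ∀ k x y → x + y < s → 2 ≤ k → 2 ≤ x → 2 ≤ y → P k (x + y) ≤ P k x * P k y

-- A record rather than a definition, so that c, k, x and y can be inferred from a proof.
record Margin (c k x y : ℕ) : Set where
  constructor margin
  field
    bound : P k (x + y) + c * P k y < P k x * P k y

open Margin using (bound)

margin-weaken : ∀ {c′ c k x y} → c′ ≤ c → Margin c k x y → Margin c′ k x y
margin-weaken {k = k} {x} {y} c′≤c (margin h) =
  margin (≤-<-trans (+-monoʳ-≤ (P k (x + y)) (*-monoˡ-≤ (P k y) c′≤c)) h)

margin-0⇒< : ∀ {k x y} → Margin 0 k x y → P k (x + y) < P k x * P k y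
margin-0⇒< {k} {x} {y} (margin h) = subst (_< P k x * P k y) (+-identityʳ (P k (x + y))) h

P-suc-level-≤ : ∀ k {x y} → x < fibPart k → y ≤ x → P (suc k) (x + y) ≤ P k (x + y) + P k y
P-suc-level-≤ k {x} {y} x<f y≤x with split (fibPart k) (x + y)
... | below x+y<f = ≤-trans (≤-reflexive (P-suc-below k x+y<f)) (m≤m+n _ _)
... | above m eq  = begin
  P (suc k) (x + y)          ≡⟨ P-suc-above k m eq ⟩
  P k (x + y) + P (suc k) m  ≤⟨ +-monoʳ-≤ (P k (x + y)) (P-mono k (<⇒≤ m<y)) ⟩
  P k (x + y) + P (suc k) y  ≡⟨ cong (P k (x + y) +_) (P-suc-below k (≤-<-trans y≤x x<f)) ⟩
  P k (x + y) + P k y        ∎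
  where
    open ≤-Reasoning
    m<y : m < y
    m<y = +-cancelʳ-< (fibPart k) m y
            (subst (_< y + fibPart k) eq (subst (x + y <_) (+-comm (fibPart k) y) (+-monoˡ-< y x<f)))

margin-suc-level : ∀ {c k x y} → x < fibPart k → y ≤ x → Margin (suc c) k x y → Margin c (suc k) x y
margin-suc-level {c} {k} {x} {y} x<f y≤x (margin h) = margin (begin-strict
  P (suc k) (x + y) + c * P (suc k) y  ≡⟨ cong (λ Y → P (suc k) (x + y) + c * Y) P-y ⟩
  P (suc k) (x + y) + c * P k y        ≤⟨ +-monoˡ-≤ (c * P k y) (P-suc-level-≤ k x<f y≤x) ⟩
  P k (x + y) + P k y + c * P k y      ≡⟨ +-assoc (P k (x + y)) (P k y) (c * P k y) ⟩
  P k (x + y) + suc c * P k y          <⟨ h ⟩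
  P k x * P k y                        ≡⟨ sym (cong₂ _*_ (P-suc-below k x<f) P-y) ⟩
  P (suc k) x * P (suc k) y            ∎)
  where
    open ≤-Reasoning
    P-y : P (suc k) y ≡ P k y
    P-y = P-suc-below k (≤-<-trans y≤x x<f)

margin-suc-level-below : ∀ {c k x y} → x + y < fibPart k → Margin c k x y → Margin c (suc k) x y
margin-suc-level-below {c} {k} {x} {y} x+y<f (margin h) = margin (begin-strict
  P (suc k) (x + y) + c * P (suc k) y  ≡⟨ cong₂ (λ S Y → S + c * Y) (P-suc-below k x+y<f) P-y ⟩
  P k (x + y) + c * P k y              <⟨ h ⟩
  P k x * P k y                        ≡⟨ sym (cong₂ _*_ (P-suc-below k (≤-<-trans (m≤m+n x y) x+y<f)) P-y) ⟩
  P (suc k) x * P (suc k) y            ∎)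
  where
    open ≤-Reasoning
    P-y : P (suc k) y ≡ P k y
    P-y = P-suc-below k (≤-<-trans (m≤n+m y x) x+y<f)

module _ {a b : ℕ} (16≤a : 16 ≤ a) (2≤b : 2 ≤ b) (ih : SubmultiplicativeBelow (a + b)) where

  fibPart≤a : ∀ {i} → i ≤ 2 → fibPart i ≤ a
  fibPart≤a i≤2 = ≤-trans (fibPart-mono i≤2) (≤-trans (s≤s (s≤s (s≤s z≤n))) 16≤a)

  9≤P-a : ∀ j → 9 ≤ P (2 + j) a
  9≤P-a j = begin
    9             ≡⟨ sym P-two-sixteen ⟩
    P 2 16        ≤⟨ P-mono 1 16≤a ⟩
    P 2 a         ≤⟨ P-level-mono a (m≤m+n 2 j) ⟩
    P (2 + j) a   ∎
    where open ≤-Reasoning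

  3≤P-a : ∀ j → 3 ≤ P (2 + j) a
  3≤P-a j = ≤-trans (s≤s (s≤s (s≤s z≤n))) (9≤P-a j)

  P-suc-≤-2* : ∀ j {n} → 2 ≤ n → suc n < a + b → P (2 + j) (suc n) ≤ 2 * P (2 + j) n
  P-suc-≤-2* j {1} (s≤s ()) _
  P-suc-≤-2* j {2} _ _ = begin
    P (2 + j) 3        ≤⟨ P-three-≤ (2 + j) ⟩
    3                  ≤⟨ n≤1+n 3 ⟩
    2 * 2              ≡⟨ cong (2 *_) (sym (P-two (m≤m+n 2 j))) ⟩
    2 * P (2 + j) 2    ∎
    where open ≤-Reasoning
  P-suc-≤-2* j {suc n@(suc (suc _))} _ 1+n<a+b = begin
    P (2 + j) (2 + n)          ≡⟨ cong (P (2 + j)) (+-comm 2 n) ⟩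
    P (2 + j) (n + 2)          ≤⟨ ih (2 + j) n 2 n+2<a+b (m≤m+n 2 j) (s≤s (s≤s z≤n)) ≤-refl ⟩
    P (2 + j) n * P (2 + j) 2  ≡⟨ cong (P (2 + j) n *_) (P-two (m≤m+n 2 j)) ⟩
    P (2 + j) n * 2            ≤⟨ *-monoˡ-≤ 2 (P-≤-suc (suc j) n) ⟩
    P (2 + j) (suc n) * 2      ≡⟨ *-comm (P (2 + j) (suc n)) 2 ⟩
    2 * P (2 + j) (suc n)      ∎
    where
      open ≤-Reasoning
      n+2<a+b : n + 2 < a + b
      n+2<a+b = subst (_< a + b) (+-comm 2 n) 1+n<a+b

  P-almost-submultiplicative : ∀ j {a′} → a′ < a →
                               P (2 + j) (a′ + b) ≤ P (2 + j) a′ * P (2 + j) b + P (2 + j) b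
  P-almost-submultiplicative j {zero}           _     = m≤n+m _ _
  P-almost-submultiplicative j {suc zero}       _     = begin
    P (2 + j) (1 + b)              ≤⟨ P-suc-≤-2* j 2≤b (+-monoˡ-< b (fibPart≤a (s≤s z≤n))) ⟩
    2 * P (2 + j) b                ≡⟨ +-comm (P (2 + j) b) (1 * P (2 + j) b) ⟩
    1 * P (2 + j) b + P (2 + j) b  ≡⟨ cong (λ z → z * P (2 + j) b + P (2 + j) b) (sym (P-suc-one (suc j))) ⟩
    P (2 + j) 1 * P (2 + j) b + P (2 + j) b ∎
    where open ≤-Reasoning
  P-almost-submultiplicative j {suc (suc a″)} a′<a =
    ≤-trans (ih (2 + j) (2 + a″) b (+-monoˡ-< b a′<a) (m≤m+n 2 j) (s≤s (s≤s z≤n)) 2≤b) (m≤m+n _ _)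

  module Decompose (k : ℕ) (f≤a : fibPart k ≤ a) where
    a′ : ℕ
    a′ = a ∸ fibPart k

    a≡a′+f : a ≡ a′ + fibPart k
    a≡a′+f = sym (m∸n+n≡m f≤a)

    a′<a : a′ < a
    a′<a = subst (a′ <_) (sym a≡a′+f) (m<m+n a′ (0<F-suc (suc k)))

    P-a : P (suc k) a ≡ P k a + P (suc k) a′
    P-a = P-suc-above k a′ a≡a′+f

    P-a+b : P (suc k) (a + b) ≡ P k (a + b) + P (suc k) (a′ + b)
    P-a+b = P-suc-above k (a′ + b) (trans (cong (_+ b) a≡a′+f) (xy∙z≈xz∙y a′ (fibPart k) b))

  margin-3 : ∀ j → fibPart (2 + j) ≤ a → Margin 3 (2 + j) a b
  margin-3 zero    _   = margin (margin-base (P-two-subadditive a b) (9≤P-a 0) 2≤P-b)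
    where
      2≤P-b : 2 ≤ P 2 b
      2≤P-b = subst (_≤ P 2 b) P-two-two (P-mono 1 2≤b)
  margin-3 (suc j) f≤a = margin
    (subst₂ (λ S X → S + 3 * P (3 + j) b < X * P (3 + j) b) (sym P-a+b) (sym P-a)
      (margin-add {S = P (2 + j) (a + b)} (bound (margin-3 j f′≤a))
                  (ih (3 + j) a′ b (+-monoˡ-< b a′<a) (m≤m+n 2 (suc j)) 2≤a′ 2≤b)
                  (3≤P-a j)
                  (P-≤-suc-level (2 + j) b)))
    where
      f′≤a : fibPart (2 + j) ≤ a
      f′≤a = ≤-trans (fibPart-≤-suc (2 + j)) f≤a
      open Decompose (2 + j) f′≤a
      f″≤a′ : fibPart (1 + j) ≤ a′
      f″≤a′ = subst (_≤ a′) (m+n∸m≡n (fibPart (2 + j)) (fibPart (1 + j))) (∸-monoˡ-≤ (fibPart (2 + j)) f≤a)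
      2≤a′ : 2 ≤ a′
      2≤a′ = ≤-trans (fibPart-mono {1} {1 + j} (s≤s z≤n)) f″≤a′

  margin-2 : ∀ j → fibPart (1 + j) ≤ a → Margin 2 (2 + j) a b
  margin-2 zero    _   = margin-weaken (n≤1+n 2) (margin-3 0 (fibPart≤a ≤-refl))
  margin-2 (suc j) f≤a = margin
    (subst₂ (λ S X → S + 2 * P (3 + j) b < X * P (3 + j) b) (sym P-a+b) (sym P-a)
      (margin-add-2 {S = P (2 + j) (a + b)} (bound (margin-3 j f≤a))
                    (P-almost-submultiplicative (suc j) a′<a)
                    (3≤P-a j)
                    (P-≤-suc-level (2 + j) b)))
    where open Decompose (2 + j) f≤a

  margin-1 : ∀ j → b ≤ a → fibPart j ≤ a → Margin 1 (2 + j) a b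
  margin-1 j b≤a _ with fibPart (1 + j) ≤? a
  ... | yes f≤a = margin-weaken (n≤1+n 1) (margin-2 j f≤a)
  margin-1 zero    b≤a _   | no f≰a = ⊥-elim (f≰a (fibPart≤a (s≤s z≤n)))
  margin-1 (suc j) b≤a f≤a | no f≰a = margin-suc-level (≰⇒> f≰a) b≤a (margin-2 j f≤a)

  margin-0 : ∀ j → b ≤ a → Margin 0 (2 + j) a b
  margin-0 j b≤a with fibPart j ≤? a
  ... | yes f≤a = margin-weaken z≤n (margin-1 j b≤a f≤a)
  margin-0 zero    b≤a | no f≰a = ⊥-elim (f≰a (fibPart≤a z≤n))
  margin-0 (suc j) b≤a | no f≰a with split (fibPart (2 + j)) (a + b)
  ... | below a+b<f = margin-suc-level-below a+b<f (margin-0 j b≤a)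
  ... | above m eq  = margin-suc-level a<f b≤a (margin-1 j b≤a fj≤a)
    where
      a<f′ : a < fibPart (1 + j)
      a<f′ = ≰⇒> f≰a
      a<f : a < fibPart (2 + j)
      a<f = <-≤-trans a<f′ (fibPart-≤-suc (1 + j))
      f≤a+b : fibPart (2 + j) ≤ a + b
      f≤a+b = subst (fibPart (2 + j) ≤_) (sym eq) (m≤n+m _ m)
      fj≤a : fibPart j ≤ a
      fj≤a = ≮⇒≥ λ a<fj → <⇒≱ (+-mono-< a<f′ (≤-<-trans b≤a a<fj)) f≤a+b

P-strict-ordered : ∀ {k x y} → 2 ≤ k → 16 ≤ x → 2 ≤ y → y ≤ x → SubmultiplicativeBelow (x + y) →
                   P k (x + y) < P k x * P k y
P-strict-ordered {1} (s≤s ())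
P-strict-ordered {suc (suc j)} _ 16≤x 2≤y y≤x ih = margin-0⇒< (margin-0 16≤x 2≤y ih j y≤x)

P-strict : ∀ {k x y} → 2 ≤ k → 2 ≤ x → 2 ≤ y → 16 ≤ x ⊎ 16 ≤ y → SubmultiplicativeBelow (x + y) →
           P k (x + y) < P k x * P k y
P-strict {k} {x} {y} 2≤k 2≤x 2≤y large ih with ≤-total y x
... | inj₁ y≤x = P-strict-ordered 2≤k ([ id , flip ≤-trans y≤x ]′ large) 2≤y y≤x ih
... | inj₂ x≤y = subst₂ _<_ (cong (P k) (+-comm y x)) (*-comm (P k y) (P k x))
                   (P-strict-ordered 2≤k ([ flip ≤-trans x≤y , id ]′ large) 2≤x x≤y
                     (subst SubmultiplicativeBelow (+-comm x y) ih))

-- Small cases and the theorem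

SmallCase : ℕ → ℕ → ℕ → Set
SmallCase k x y = 2 ≤ k → 2 ≤ x → 2 ≤ y → P k (x + y) ≤ P k x * P k y

StrictSmallCase : ℕ → ℕ → Set
StrictSmallCase x y = 6 ≤ x → 6 ≤ y → P 7 (x + y) < P 7 x * P 7 y

opaque
  unfolding P

  small-cases : ∀ {k} → k < 8 → ∀ {x} → x < 16 → ∀ {y} → y < 16 → SmallCase k x y
  small-cases = toWitness {a? = allUpTo? (λ k → allUpTo? (λ x → allUpTo? (small? k x) 16) 16) 8} _
    where
      small? : ∀ k x y → Dec (SmallCase k x y)
      small? k x y = 2 ≤? k →-dec 2 ≤? x →-dec 2 ≤? y →-dec P k (x + y) ≤? P k x * P k y

  strict-small-cases : ∀ {x} → x < 16 → ∀ {y} → y < 16 → StrictSmallCase x y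
  strict-small-cases = toWitness {a? = allUpTo? (λ x → allUpTo? (strict? x) 16) 16} _
    where
      strict? : ∀ x y → Dec (StrictSmallCase x y)
      strict? x y = 6 ≤? x →-dec 6 ≤? y →-dec P 7 (x + y) <? P 7 x * P 7 y

+<fibPart-7 : ∀ {x y} → x < 16 → y < 16 → x + y < fibPart 7
+<fibPart-7 x<16 y<16 = <-≤-trans (+-mono-< x<16 y<16) (m≤m+n 32 2)

P-small-submultiplicative : ∀ {k x y} → 2 ≤ k → 2 ≤ x → x < 16 → 2 ≤ y → y < 16 →
                            P k (x + y) ≤ P k x * P k y
P-small-submultiplicative {k} {x} {y} 2≤k 2≤x x<16 2≤y y<16 with k ≤? 7
... | yes k≤7 = small-cases (s≤s k≤7) x<16 y<16 2≤k 2≤x 2≤y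
... | no  k≰7 =
  subst₂ _≤_ (sym (stable ≤-refl)) (sym (cong₂ _*_ (stable (m≤m+n x y)) (stable (m≤n+m y x))))
    (small-cases ≤-refl x<16 y<16 (s≤s (s≤s z≤n)) 2≤x 2≤y)
  where
    stable : ∀ {n} → n ≤ x + y → P k n ≡ P 7 n
    stable n≤x+y = P-stable (<⇒≤ (≰⇒> k≰7)) (≤-<-trans n≤x+y (+<fibPart-7 x<16 y<16))

P-submultiplicative-step : ∀ {k x y} → SubmultiplicativeBelow (x + y) → 2 ≤ k → 2 ≤ x → 2 ≤ y →
                           P k (x + y) ≤ P k x * P k y
P-submultiplicative-step {x = x} {y} ih 2≤k 2≤x 2≤y with 16 ≤? x ⊎-dec 16 ≤? y
... | yes large = <⇒≤ (P-strict 2≤k 2≤x 2≤y large ih)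
... | no  small = P-small-submultiplicative 2≤k 2≤x (≰⇒> (small ∘ inj₁)) 2≤y (≰⇒> (small ∘ inj₂))

P-submultiplicative-below : ∀ s → SubmultiplicativeBelow s
P-submultiplicative-below (suc s) k x y x+y<1+s = P-submultiplicative-step ih
  where
    ih : SubmultiplicativeBelow (x + y)
    ih k′ x′ y′ lt = P-submultiplicative-below s k′ x′ y′ (<-≤-trans lt (≤-pred x+y<1+s))

pF-strict-large : ∀ {x y} → 2 ≤ x → 2 ≤ y → 16 ≤ x ⊎ 16 ≤ y → pF (x + y) < pF x * pF y
pF-strict-large {x} {y} 2≤x 2≤y large =
  subst₂ _<_ (sym (pF≡P x+y<f)) (sym (cong₂ _*_ (pF≡P (≤-<-trans (m≤m+n x y) x+y<f))
                                                (pF≡P (≤-<-trans (m≤n+m y x) x+y<f))))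
    (P-strict (≤-trans 2≤x (m≤m+n x y)) 2≤x 2≤y large (P-submultiplicative-below (x + y)))
  where
    x+y<f : x + y < fibPart (x + y)
    x+y<f = n<fibPart (x + y)

pF-strict-small : ∀ {x y} → 6 ≤ x → x < 16 → 6 ≤ y → y < 16 → pF (x + y) < pF x * pF y
pF-strict-small {x} {y} 6≤x x<16 6≤y y<16 =
  subst₂ _<_ (sym (as-P ≤-refl)) (sym (cong₂ _*_ (as-P (m≤m+n x y)) (as-P (m≤n+m y x))))
    (strict-small-cases x<16 y<16 6≤x 6≤y)
  where
    as-P : ∀ {n} → n ≤ x + y → pF n ≡ P 7 n
    as-P n≤x+y = pF≡P (≤-<-trans n≤x+y (+<fibPart-7 x<16 y<16))

theorem6p1 : (a b : ℕ) → 6 ≤ a → 6 ≤ b → pF (a + b) < pF a * pF b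
theorem6p1 a b 6≤a 6≤b with 16 ≤? a ⊎-dec 16 ≤? b
... | yes large = pF-strict-large (≤-trans 2≤6 6≤a) (≤-trans 2≤6 6≤b) large
  where
    2≤6 : 2 ≤ 6
    2≤6 = s≤s (s≤s z≤n)
... | no  small = pF-strict-small 6≤a (≰⇒> (small ∘ inj₁)) 6≤b (≰⇒> (small ∘ inj₂))
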